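{- Let $P$ be a poset, $X,Y$ disjoint posets, and $e_X:P\to X$, $e_Y:P\to Y$ order embeddings. Define $R_l\subseteq X\times Y$ by $x\mathrel{R_l}y\iff e_X^{ -1}(x^\uparrow)\cap e_Y^{ -1}(y^\downarrow)\neq\emptyset$. Then: (1) for each $n\in\{0,1,2,3\}$, the set of relations $R\subseteq X\times Y$ such that $(e_X,e_Y,R)$ is $n$-coherent is closed under non-empty intersections; (2) $(e_X,e_Y,R_l)$ is 2-coherent; (3) if $R\subseteq X\times Y$ and $(e_X,e_Y,R)$ is 1-coherent, then $R_l\subseteq R$; (4) if $e_X$ is a meet-extension and $e_Y$ is a join-extension, then $(e_X,e_Y,R_l)$ is 3-coherent (and thus a Galois polarity); (5) if $(e_X,e_Y,R_l)$ is not 3-coherent, then there is no $R\subseteq X\times Y$ such that $(e_X,e_Y,R)$ is 3-coherent.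
   Context: For a poset $Q$, $q^\uparrow=\{r:r\ge q\}$, $q^\downarrow=\{r:r\le q\}$. An order embedding $e:P\to Q$ is a meet-extension if $q=\bigwedge e[e^{ -1}(q^\uparrow)]$ for all $q$, and a join-extension if $q=\bigvee e[e^{ -1}(q^\downarrow)]$ for all $q$. For $R\subseteq X\times Y$ consider the conditions (all variables range over $X$, $Y$, $P$ as appropriate): (C1) $x_1\le_X x_2$ and $x_2\mathrel{R}y$ imply $x_1\mathrel{R}y$; (C2) $y_1\le_Y y_2$ and $x\mathrel{R}y_1$ imply $x\mathrel{R}y_2$; (C3) $e_X(p)\mathrel{R}e_Y(p)$ for all $p$; (C4) $x\mathrel{R}e_Y(p)$ and $e_X(p)\mathrel{R}y$ imply $x\mathrel{R}y$; (C5) $x_1\mathrel{R}e_Y(p)$ and $e_X(p)\le_X x_2$ imply $x_1\le_X x_2$; (C6) $y_1\le_Y e_Y(p)$ and $e_X(p)\mathrel{R}y_2$ imply $y_1\le_Y y_2$; (C7) if $S\subseteq P$, $\bigwedge e_X[S]=x$ in $X$, $x\mathrel{R}y_2$ and $y_1\le_Y e_Y(p)$ for all $p\in S$, then $y_1\le_Y y_2$; (C8) if $T\subseteq P$, $\bigvee e_Y[T]=y$ in $Y$, $x_1\mathrel{R}y$ and $e_X(q)\le_X x_2$ for all $q\in T$, then $x_1\le_X x_2$. $(e_X,e_Y,R)$ is 0-coherent if (C1),(C2) hold; 1-coherent if (C1)–(C4); 2-coherent if (C1)–(C6); 3-coherent if (C1)–(C8). A Galois polarity is a 3-coherent $(e_X,e_Y,R)$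 with $e_X$ a meet-extension and $e_Y$ a join-extension. -}

module Defs where

import Level
open import Level using (Level; _⊔_)
open import Data.Product using (Σ; _×_; ∃; ∃-syntax; _,_)
open import Relation.Unary using (Pred)
open import Relation.Binary.Core using (REL)
open import Relation.Binary.Bundles using (Poset)
open import Relation.Binary.Morphism.Structures using (IsOrderMonomorphism)

IsOrderEmbedding : ∀ {a₁ a₂ a₃ b₁ b₂ b₃} (P : Poset a₁ a₂ a₃) (Q : Poset b₁ b₂ b₃)
                   → (Poset.Carrier P → Poset.Carrier Q) → Set _
IsOrderEmbedding P Q e =
  IsOrderMonomorphism (Poset._≈_ P) (Poset._≈_ Q) (Poset._≤_ P) (Poset._≤_ Q) e

module _ {a₁ a₂ a₃ b₁ b₂ b₃ : Level} (P : Poset a₁ a₂ a₃) (Q : Poset b₁ b₂ b₃) where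
  private
    module P = Poset P
    module Q = Poset Q

  IsMeetOfImage : ∀ {s} → (P.Carrier → Q.Carrier) → Pred P.Carrier s → Q.Carrier → Set _
  IsMeetOfImage e S q =
    (∀ p → S p → q Q.≤ e p) ×
    (∀ z → (∀ p → S p → z Q.≤ e p) → z Q.≤ q)

  IsJoinOfImage : ∀ {s} → (P.Carrier → Q.Carrier) → Pred P.Carrier s → Q.Carrier → Set _
  IsJoinOfImage e S q =
    (∀ p → S p → e p Q.≤ q) ×
    (∀ z → (∀ p → S p → e p Q.≤ z) → q Q.≤ z)

  IsMeetExtension : (P.Carrier → Q.Carrier) → Set _
  IsMeetExtension e = IsOrderEmbedding P Q e ×
    (∀ q → IsMeetOfImage e (λ p → q Q.≤ e p) q)

  IsJoinExtension : (P.Carrier → Q.Carrier) → Set _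
  IsJoinExtension e = IsOrderEmbedding P Q e ×
    (∀ q → IsJoinOfImage e (λ p → e p Q.≤ q) q)

module Coherence {p₁ p₂ p₃ x₁ x₂ x₃ y₁ y₂ y₃ : Level} (ℓS : Level)
  (P : Poset p₁ p₂ p₃) (X : Poset x₁ x₂ x₃) (Y : Poset y₁ y₂ y₃)
  (eX : Poset.Carrier P → Poset.Carrier X) (eY : Poset.Carrier P → Poset.Carrier Y) where
  private
    module P = Poset P
    module X = Poset X
    module Y = Poset Y

  module _ {r : Level} (R : REL X.Carrier Y.Carrier r) where
    C1 : Set _
    C1 = ∀ x₁ x₂ y → x₁ X.≤ x₂ → R x₂ y → R x₁ y
    C2 : Set _
    C2 = ∀ x y₁ y₂ → y₁ Y.≤ y₂ → R x y₁ → R x y₂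
    C3 : Set _
    C3 = ∀ p → R (eX p) (eY p)
    C4 : Set _
    C4 = ∀ x y p → R x (eY p) → R (eX p) y → R x y
    C5 : Set _
    C5 = ∀ x₁ x₂ p → R x₁ (eY p) → eX p X.≤ x₂ → x₁ X.≤ x₂
    C6 : Set _
    C6 = ∀ y₁ y₂ p → y₁ Y.≤ eY p → R (eX p) y₂ → y₁ Y.≤ y₂
    C7 : Set _
    C7 = ∀ (S : Pred P.Carrier ℓS) x y₁ y₂ → IsMeetOfImage P X eX S x → R x y₂
         → (∀ p → S p → y₁ Y.≤ eY p) → y₁ Y.≤ y₂
    C8 : Set _
    C8 = ∀ (T : Pred P.Carrier ℓS) y x₁ x₂ → IsJoinOfImage P Y eY T y → R x₁ y
         → (∀ q → T q → eX q X.≤ x₂) → x₁ X.≤ x₂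

    Coherent0 : Set _
    Coherent0 = C1 × C2
    Coherent1 : Set _
    Coherent1 = Coherent0 × C3 × C4
    Coherent2 : Set _
    Coherent2 = Coherent1 × C5 × C6
    Coherent3 : Set _
    Coherent3 = Coherent2 × C7 × C8

  Rl : REL X.Carrier Y.Carrier (p₁ ⊔ x₃ ⊔ y₃)
  Rl x y = ∃[ p ] (x X.≤ eX p × eY p Y.≤ y)

  ⋂ : ∀ {i r} {I : Set i} → (I → REL X.Carrier Y.Carrier r) → REL X.Carrier Y.Carrier (i ⊔ r)
  ⋂ {I = I} Rs x y = ∀ (i : I) → Rs i x y

  _⊆R_ : ∀ {r s} → REL X.Carrier Y.Carrier r → REL X.Carrier Y.Carrier s → Set _
  R ⊆R S = ∀ x y → R x y → S x y

-- Conditions (C1)–(C4) are Horn conditions with R in the conclusion, so they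
-- are preserved by arbitrary intersections, while (C5)–(C8) mention R only in
-- hypotheses, so they pass from a relation to any subrelation; intersections
-- inherit them from a single member. R_l is generated by (C1)–(C3) from the
-- pairs (e_X p, e_Y p), hence it is the least 1-coherent relation, and thus
-- 3-coherent as soon as any relation is. Transitivity through P, via the
-- embeddings, gives (C4)–(C6) for R_l; with join-density of e_Y (resp.
-- meet-density of e_X) it also gives (C7) (resp. (C8)).
module Submission where

open import Defs
open import Level using (Level)
open import Data.Product using (_×_; _,_; proj₁; proj₂)
open import Function using (_∘_)
open import Relation.Nullary using (¬_)
open import Relation.Binary.Core using (REL)
open import Relation.Binary.Bundles using (Poset)
open import Relation.Binary.Morphism.Structures using (IsOrderMonomorphism)

module CoherenceProperties {p₁ p₂ p₃ x₁ x₂ x₃ y₁ y₂ y₃ : Level} (ℓS : Level)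
  (P : Poset p₁ p₂ p₃) (X : Poset x₁ x₂ x₃) (Y : Poset y₁ y₂ y₃)
  (eX : Poset.Carrier P → Poset.Carrier X) (eY : Poset.Carrier P → Poset.Carrier Y) where

  open Coherence ℓS P X Y eX eY
  private
    module X = Poset X
    module Y = Poset Y

  module _ {r r′} {R : REL X.Carrier Y.Carrier r} {R′ : REL X.Carrier Y.Carrier r′}
           (R⊆R′ : R ⊆R R′) where

    C5-antitone : C5 R′ → C5 R
    C5-antitone c5 x₁ x₂ p x₁Rp = c5 x₁ x₂ p (R⊆R′ x₁ (eY p) x₁Rp)

    C6-antitone : C6 R′ → C6 R
    C6-antitone c6 y₁ y₂ p y₁≤p pRy₂ = c6 y₁ y₂ p y₁≤p (R⊆R′ (eX p) y₂ pRy₂)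

    C7-antitone : C7 R′ → C7 R
    C7-antitone c7 S x y₁ y₂ x-meet xRy₂ = c7 S x y₁ y₂ x-meet (R⊆R′ x y₂ xRy₂)

    C8-antitone : C8 R′ → C8 R
    C8-antitone c8 T y x₁ x₂ y-join x₁Ry = c8 T y x₁ x₂ y-join (R⊆R′ x₁ y x₁Ry)

    Coherent2-restrict : Coherent1 R → Coherent2 R′ → Coherent2 R
    Coherent2-restrict c (_ , c5 , c6) = c , C5-antitone c5 , C6-antitone c6

    Coherent3-restrict : Coherent2 R → Coherent3 R′ → Coherent3 R
    Coherent3-restrict c (_ , c7 , c8) = c , C7-antitone c7 , C8-antitone c8

  module _ {i r} {I : Set i} (Rs : I → REL X.Carrier Y.Carrier r) where

    ⋂-lower : ∀ j → ⋂ Rs ⊆R Rs j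
    ⋂-lower j x y x⋂y = x⋂y j

    ⋂-C1 : (∀ j → C1 (Rs j)) → C1 (⋂ Rs)
    ⋂-C1 c1 x₁ x₂ y x₁≤x₂ x₂Ry j = c1 j x₁ x₂ y x₁≤x₂ (x₂Ry j)

    ⋂-C2 : (∀ j → C2 (Rs j)) → C2 (⋂ Rs)
    ⋂-C2 c2 x y₁ y₂ y₁≤y₂ xRy₁ j = c2 j x y₁ y₂ y₁≤y₂ (xRy₁ j)

    ⋂-C3 : (∀ j → C3 (Rs j)) → C3 (⋂ Rs)
    ⋂-C3 c3 p j = c3 j p

    ⋂-C4 : (∀ j → C4 (Rs j)) → C4 (⋂ Rs)
    ⋂-C4 c4 x y p xRp pRy j = c4 j x y p (xRp j) (pRy j)

    ⋂-coherent0 : (∀ j → Coherent0 (Rs j)) → Coherent0 (⋂ Rs)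
    ⋂-coherent0 c = ⋂-C1 (proj₁ ∘ c) , ⋂-C2 (proj₂ ∘ c)

    ⋂-coherent1 : (∀ j → Coherent1 (Rs j)) → Coherent1 (⋂ Rs)
    ⋂-coherent1 c =
      ⋂-coherent0 (proj₁ ∘ c) , ⋂-C3 (proj₁ ∘ proj₂ ∘ c) , ⋂-C4 (proj₂ ∘ proj₂ ∘ c)

    ⋂-coherent2 : I → (∀ j → Coherent2 (Rs j)) → Coherent2 (⋂ Rs)
    ⋂-coherent2 j c = Coherent2-restrict (⋂-lower j) (⋂-coherent1 (proj₁ ∘ c)) (c j)

    ⋂-coherent3 : I → (∀ j → Coherent3 (Rs j)) → Coherent3 (⋂ Rs)
    ⋂-coherent3 j c = Coherent3-restrict (⋂-lower j) (⋂-coherent2 j (proj₁ ∘ c)) (c j)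

  Rl-least : ∀ {r} {R : REL X.Carrier Y.Carrier r} → C1 R → C2 R → C3 R → Rl ⊆R R
  Rl-least c1 c2 c3 x y (p , x≤p , p≤y) = c2 x (eY p) y p≤y (c1 x (eX p) (eY p) x≤p (c3 p))

  module _ (eX-embedding : IsOrderEmbedding P X eX) (eY-embedding : IsOrderEmbedding P Y eY) where
    private
      module EX = IsOrderMonomorphism eX-embedding
      module EY = IsOrderMonomorphism eY-embedding

    eX-≤⇒eY-≤ : ∀ {p q} → eX p X.≤ eX q → eY p Y.≤ eY q
    eX-≤⇒eY-≤ = EY.mono ∘ EX.cancel

    eY-≤⇒eX-≤ : ∀ {p q} → eY p Y.≤ eY q → eX p X.≤ eX q
    eY-≤⇒eX-≤ = EX.mono ∘ EY.cancel

    Rl-coherent2 : Coherent2 Rl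
    Rl-coherent2 = ((c1 , c2) , c3 , c4) , c5 , c6
      where
      c1 : C1 Rl
      c1 x₁ x₂ y x₁≤x₂ (p , x₂≤p , p≤y) = p , X.trans x₁≤x₂ x₂≤p , p≤y
      c2 : C2 Rl
      c2 x y₁ y₂ y₁≤y₂ (p , x≤p , p≤y₁) = p , x≤p , Y.trans p≤y₁ y₁≤y₂
      c3 : C3 Rl
      c3 p = p , X.refl , Y.refl
      c4 : C4 Rl
      c4 x y p (q , x≤q , q≤p) (s , p≤s , s≤y) =
        q , x≤q , Y.trans q≤p (Y.trans (eX-≤⇒eY-≤ p≤s) s≤y)
      c5 : C5 Rl
      c5 x₁ x₂ p (q , x₁≤q , q≤p) p≤x₂ = X.trans x₁≤q (X.trans (eY-≤⇒eX-≤ q≤p) p≤x₂)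
      c6 : C6 Rl
      c6 y₁ y₂ p y₁≤p (q , p≤q , q≤y₂) = Y.trans y₁≤p (Y.trans (eX-≤⇒eY-≤ p≤q) q≤y₂)

    -- y₁ is the join of the eY s below it, and each such eX s is a lower bound
    -- of eX[S], hence lies below the meet x ≤ eX q.
    Rl-C7 : IsJoinExtension P Y eY → C7 Rl
    Rl-C7 (_ , join-dense) S x y₁ y₂ (_ , x-greatest) (q , x≤q , q≤y₂) y₁≤S =
      Y.trans (proj₂ (join-dense y₁) (eY q) below-y₁⇒below-q) q≤y₂
      where
      below-y₁⇒below-q : ∀ s → eY s Y.≤ y₁ → eY s Y.≤ eY q
      below-y₁⇒below-q s s≤y₁ = eX-≤⇒eY-≤ (X.trans s≤x x≤q)
        where
        s≤x : eX s X.≤ x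
        s≤x = x-greatest (eX s) (λ p p∈S → eY-≤⇒eX-≤ (Y.trans s≤y₁ (y₁≤S p p∈S)))

    Rl-C8 : IsMeetExtension P X eX → C8 Rl
    Rl-C8 (_ , meet-dense) T y x₁ x₂ (_ , y-least) (q , x₁≤q , q≤y) T≤x₂ =
      X.trans x₁≤q (proj₂ (meet-dense x₂) (eX q) above-x₂⇒above-q)
      where
      above-x₂⇒above-q : ∀ s → x₂ X.≤ eX s → eX q X.≤ eX s
      above-x₂⇒above-q s x₂≤s = eY-≤⇒eX-≤ (Y.trans q≤y y≤s)
        where
        y≤s : y Y.≤ eY s
        y≤s = y-least (eY s) (λ p p∈T → eX-≤⇒eY-≤ (X.trans (T≤x₂ p p∈T) x₂≤s))

    Rl-coherent3 : IsMeetExtension P X eX → IsJoinExtension P Y eY → Coherent3 Rl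
    Rl-coherent3 eX-meet eY-join = Rl-coherent2 , Rl-C7 eY-join , Rl-C8 eX-meet

    Rl-coherent3-if-any : ∀ {r} {R : REL X.Carrier Y.Carrier r} → Coherent3 R → Coherent3 Rl
    Rl-coherent3-if-any c@((((c1 , c2) , c3 , _) , _) , _) =
      Coherent3-restrict (Rl-least c1 c2 c3) Rl-coherent2 c

proposition5p2 : ∀ {p₁ p₂ p₃ x₁ x₂ x₃ y₁ y₂ y₃ : Level} (ℓS i r : Level)
    (P : Poset p₁ p₂ p₃) (X : Poset x₁ x₂ x₃) (Y : Poset y₁ y₂ y₃)
    (eX : Poset.Carrier P → Poset.Carrier X) (eY : Poset.Carrier P → Poset.Carrier Y)
    → IsOrderEmbedding P X eX → IsOrderEmbedding P Y eY
    → let open Coherence ℓS P X Y eX eY in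
      -- (1) closure under non-empty intersections, n = 0,1,2,3
      ((I : Set i) (Rs : I → REL (Poset.Carrier X) (Poset.Carrier Y) r)
         → I → (∀ j → Coherent0 (Rs j)) → Coherent0 (⋂ Rs))
      × ((I : Set i) (Rs : I → REL (Poset.Carrier X) (Poset.Carrier Y) r)
         → I → (∀ j → Coherent1 (Rs j)) → Coherent1 (⋂ Rs))
      × ((I : Set i) (Rs : I → REL (Poset.Carrier X) (Poset.Carrier Y) r)
         → I → (∀ j → Coherent2 (Rs j)) → Coherent2 (⋂ Rs))
      × ((I : Set i) (Rs : I → REL (Poset.Carrier X) (Poset.Carrier Y) r)
         → I → (∀ j → Coherent3 (Rs j)) → Coherent3 (⋂ Rs))
      -- (2) R_l is 2-coherent
      × Coherent2 Rl
      -- (3) R_l is contained in every 1-coherent R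
      × ((R : REL (Poset.Carrier X) (Poset.Carrier Y) r) → Coherent1 R → Rl ⊆R R)
      -- (4) meet-extension + join-extension ⇒ R_l is 3-coherent
      × (IsMeetExtension P X eX → IsJoinExtension P Y eY → Coherent3 Rl)
      -- (5) R_l not 3-coherent ⇒ no 3-coherent R
      × (¬ Coherent3 Rl → (R : REL (Poset.Carrier X) (Poset.Carrier Y) r) → ¬ Coherent3 R)
proposition5p2 ℓS i r P X Y eX eY eX-embedding eY-embedding =
    (λ _ Rs _ → ⋂-coherent0 Rs)
  , (λ _ Rs _ → ⋂-coherent1 Rs)
  , (λ _ → ⋂-coherent2)
  , (λ _ → ⋂-coherent3)
  , Rl-coherent2 eX-embedding eY-embedding
  , (λ _ (((c1 , c2) , c3 , _)) → Rl-least c1 c2 c3)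
  , Rl-coherent3 eX-embedding eY-embedding
  , (λ ¬Rl-coherent3 _ → ¬Rl-coherent3 ∘ Rl-coherent3-if-any eX-embedding eY-embedding)
  where open CoherenceProperties ℓS P X Y eX eY
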